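{- Let $G$ be a connected graph on $n$ vertices. Then: (i) if $G$ is distance regular, then $\iota(G)=\frac{2W(G)}{n^2}$; (ii) if $G$ is a tree, then $\iota(G)=\frac{n-1}{2}$.
   Context: All graphs are finite, simple, undirected. For a connected graph $G$ with vertices $v_1,\dots,v_n$, $D=(d(v_i,v_j))_{i,j}$ is its shortest-path distance matrix and $\vec 1$ the all-ones vector. A curvature potential is a vector $\vec x$ with $D\vec x=\vec 1$; $G$ is distance exceptional if it has no curvature potential. Let $X(G)=\{D\vec x:\vec x\in\mathbb{R}^n,\ \vec x^\top\vec 1=1\}$. If $G$ is distance exceptional or has a curvature potential $\vec x$ with $\vec 1^\top\vec x\ne 0$, then $X(G)\cap\mathbb{R}\vec 1$ is a single point, and the curvature index $\iota(G)\in\mathbb{R}$ is defined by $X(G)\cap\mathbb{R}\vec 1=\{\iota(G)\vec 1\}$; otherwise $\iota(G):=\infty$. The Wiener index is $W(G)=\frac12\sum_{u,v\in V}d(u,v)$.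
   Formalization: Curvature potentials, distance exceptionality, the set X(G) and the curvature index ι(G) are taken over ℚ, with vectors in ℚ^n instead of $\mathbb{R}^n$. -}

module Defs where

open import Data.Nat as ℕ using (ℕ; zero; suc; _≤_)
open import Data.Integer using (+_)
open import Data.Rational using (ℚ; 0ℚ; 1ℚ; _+_; _*_; _/_)
open import Data.Fin using (Fin; zero; suc; inject₁; fromℕ)
open import Data.Bool using (Bool; true; false)
open import Data.List using (length; filter)
open import Data.List.Base using (allFin)
open import Data.Product using (Σ; ∃; _×_; _,_)
open import Data.Sum using (_⊎_)
open import Relation.Nullary using (¬_)
open import Relation.Nullary.Decidable using (_×-dec_)
open import Relation.Binary.PropositionalEquality using (_≡_; _≢_)
open import Function.Definitions using (Injective)

record Graph (n : ℕ) : Set where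
  field
    adj   : Fin n → Fin n → Bool
    sym   : ∀ u v → adj u v ≡ adj v u
    irrefl : ∀ v → adj v v ≡ false
open Graph public

Adj : ∀ {n} → Graph n → Fin n → Fin n → Set
Adj G u v = adj G u v ≡ true

data Walk {n : ℕ} (G : Graph n) : Fin n → Fin n → ℕ → Set where
  nil  : ∀ {u} → Walk G u u 0
  cons : ∀ {u w v k} → Adj G u w → Walk G w v k → Walk G u v (suc k)

Connected : ∀ {n} → Graph n → Set
Connected G = ∀ u v → ∃ λ k → Walk G u v k

IsDistance : ∀ {n} → Graph n → (Fin n → Fin n → ℕ) → Set
IsDistance G d = ∀ u v → Walk G u v (d u v) × (∀ k → Walk G u v k → d u v ≤ k)

-- A cycle: k+3 distinct vertices f 0, ..., f (k+2), consecutive ones adjacent,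
-- and the last adjacent to the first.
HasCycle : ∀ {n} → Graph n → Set
HasCycle {n} G = Σ ℕ λ k → Σ (Fin (suc (suc (suc k))) → Fin n) λ f →
  Injective _≡_ _≡_ f ×
  (∀ (i : Fin (suc (suc k))) → Adj G (f (inject₁ i)) (f (suc i))) ×
  Adj G (f (fromℕ (suc (suc k)))) (f zero)

IsTree : ∀ {n} → Graph n → Set
IsTree G = Connected G × ¬ HasCycle G

-- Distance regularity (intersection numbers p^k_{ij} well defined)

count : ∀ {n} → (Fin n → Fin n → ℕ) → Fin n → Fin n → ℕ → ℕ → ℕ
count {n} d u v i j =
  length (filter (λ w → (d u w ℕ.≟ i) ×-dec (d v w ℕ.≟ j)) (allFin n))

DistanceRegular : ∀ {n} → (Fin n → Fin n → ℕ) → Set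
DistanceRegular d = ∀ u v u' v' → d u v ≡ d u' v' →
  ∀ i j → count d u v i j ≡ count d u' v' i j

sumFin : ∀ {n} → (Fin n → ℚ) → ℚ
sumFin {zero}  f = 0ℚ
sumFin {suc n} f = f zero + sumFin (λ i → f (suc i))

D·_ : ∀ {n} → (Fin n → Fin n → ℕ) → (Fin n → ℚ) → (Fin n → ℚ)
(D· d) x i = sumFin (λ j → ((+ d i j) / 1) * x j)

CurvaturePotential : ∀ {n} → (Fin n → Fin n → ℕ) → (Fin n → ℚ) → Set
CurvaturePotential d x = ∀ i → (D· d) x i ≡ 1ℚ

DistanceExceptional : ∀ {n} → (Fin n → Fin n → ℕ) → Set
DistanceExceptional d = ¬ (∃ λ x → CurvaturePotential d x)

InX : ∀ {n} → (Fin n → Fin n → ℕ) → (Fin n → ℚ) → Set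
InX d y = ∃ λ x → sumFin x ≡ 1ℚ × (∀ i → (D· d) x i ≡ y i)

data ℚ∞ : Set where
  fin : ℚ → ℚ∞
  ∞   : ℚ∞

FiniteCase : ∀ {n} → (Fin n → Fin n → ℕ) → Set
FiniteCase d = DistanceExceptional d ⊎ (∃ λ x → CurvaturePotential d x × sumFin x ≢ 0ℚ)

CurvatureIndex : ∀ {n} → (Fin n → Fin n → ℕ) → ℚ∞ → Set
CurvatureIndex d (fin c) =
  FiniteCase d × InX d (λ _ → c) × (∀ t → InX d (λ _ → t) → t ≡ c)
CurvatureIndex d ∞ = ¬ FiniteCase d

Wiener : ∀ {n} → (Fin n → Fin n → ℕ) → ℚ
Wiener d = (+ 1 / 2) * sumFin (λ u → sumFin (λ v → + d u v / 1))

-- Both values of ι come from an explicit vector x with 1ᵀx = 1 and Dx constant.  Since D is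
-- symmetric, xᵀDy = yᵀDx, so two such vectors give the same constant and ι is well defined; when
-- the constant c is nonzero, x/c is a curvature potential with nonzero sum, and a one-vertex
-- graph (D = 0) is distance exceptional.
--
-- Distance regular: the number of vertices at distance i from u does not depend on u, so every
-- row of D has the same sum r.  Then x = 1/n gives Dx = r/n, and 2W/n² = 2(nr/2)/n² = r/n.
--
-- Tree: take x_v = 1 - deg(v)/2.  Orienting every edge towards a root u, each vertex other than
-- u has exactly one parent, one level closer to u.  Hence there are n - 1 edges, so 1ᵀx = 1, and
-- an edge from a child v contributes d(u,v) + (d(u,v) - 1) to Σ_v deg(v) d(u,v), so that sum is
-- 2 Σ_v d(u,v) - (n - 1) and (Dx)_u = (n - 1)/2.
module Submission where

open import Defs hiding (sym)
open import Algebra.Bundles using (CommutativeMonoid; Ring)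
import Algebra.Properties.CommutativeMonoid.Sum as CommutativeMonoidSum
import Algebra.Properties.Semiring.Sum as SemiringSum
open import Data.Bool using (true)
import Data.Bool.Properties as BoolP
open import Data.Empty using (⊥; ⊥-elim)
open import Data.Fin using (Fin; zero; suc; toℕ; fromℕ<; inject₁; punchIn)
import Data.Fin as Fin
import Data.Fin.Properties as FinP
open import Data.Integer as ℤ using (+_)
import Data.Integer.Properties as ℤP
open import Data.Integer.Tactic.RingSolver using (solve-∀)
open import Data.List using (length; filter; tabulate)
open import Data.Nat using (ℕ; zero; suc)
import Data.Nat as ℕ
import Data.Nat.Properties as ℕP
open import Data.Product using (∃; _×_; _,_; proj₁; proj₂)
open import Data.Rational using (ℚ; 0ℚ; 1ℚ; fromℚᵘ)
import Data.Rational.Properties as ℚP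
open import Data.Rational.Solver using (module +-*-Solver)
open import Data.Rational.Unnormalised as ℚᵘ using (mkℚᵘ; *≡*)
import Data.Rational.Unnormalised.Properties as ℚᵘP
open import Data.Sum using (_⊎_; inj₁; inj₂)
open import Data.Vec using (Vec; []; _∷_; _∷ʳ_; lookup; head)
open import Data.Vec.Functional using (removeAt; replicate)
open import Data.Vec.Relation.Unary.All as All using (All; []; _∷_)
open import Data.Vec.Relation.Unary.AllPairs using ([]; _∷_)
open import Data.Vec.Relation.Unary.Linked using (Linked; []; [-]; _∷_)
open import Data.Vec.Relation.Unary.Unique.Propositional using (Unique)
open import Data.Vec.Relation.Unary.Unique.Propositional.Properties using (lookup-injective)
open import Function using (_∘_; id)
open import Relation.Binary.Core using (Rel)
open import Relation.Binary.Definitions using (tri<; tri≈; tri>)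
open import Relation.Binary.PropositionalEquality
  using (_≡_; _≢_; refl; sym; trans; cong; cong₂; subst; ≢-sym; module ≡-Reasoning)
open import Relation.Nullary using (Dec; yes; no; ¬_)
open import Relation.Nullary.Decidable using (_×-dec_)
open import Relation.Unary using (Pred; Decidable)

module ℕΣ = SemiringSum ℕP.+-*-semiring
module ℚΣ = SemiringSum (Ring.semiring ℚP.+-*-ring)

𝟙 : ∀ {p} {P : Set p} → Dec P → ℕ
𝟙 (yes _) = 1
𝟙 (no _)  = 0

𝟙-yes : ∀ {p} {P : Set p} (P? : Dec P) → P → 𝟙 P? ≡ 1
𝟙-yes (yes _) _ = refl
𝟙-yes (no ¬p) p = ⊥-elim (¬p p)

𝟙-no : ∀ {p} {P : Set p} (P? : Dec P) → ¬ P → 𝟙 P? ≡ 0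
𝟙-no (yes p) ¬p = ⊥-elim (¬p p)
𝟙-no (no _)  _  = refl

module _ {c ℓ} (M : CommutativeMonoid c ℓ) where
  open CommutativeMonoid M using (Carrier; _≈_; _∙_; ε; ∙-congˡ; identityʳ; setoid)
  open CommutativeMonoidSum M using (sum; sum-remove; sum-cong-≋; sum-replicate-zero)
  open import Relation.Binary.Reasoning.Setoid setoid

  sum-δ : ∀ {n} (f : Fin n → Carrier) i → (∀ j → j ≢ i → f j ≈ ε) → sum f ≈ f i
  sum-δ {suc n} f i f≈ε = begin
    sum f                     ≈⟨ sum-remove f ⟩
    f i ∙ sum (removeAt f i)  ≈⟨ ∙-congˡ (sum-cong-≋ (λ j → f≈ε (punchIn i j) (FinP.punchInᵢ≢i i j))) ⟩
    f i ∙ sum (replicate n ε) ≈⟨ ∙-congˡ (sum-replicate-zero n) ⟩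
    f i ∙ ε                   ≈⟨ identityʳ (f i) ⟩
    f i                       ∎

module _ where
  open Data.Nat using (_+_; _*_; _≤_; _<_; s≤s; _≟_)
  open ℕΣ
  open ≡-Reasoning

  term≤sum : ∀ {n} (f : Fin n → ℕ) i → f i ≤ sum f
  term≤sum f zero    = ℕP.m≤m+n _ _
  term≤sum f (suc i) = ℕP.≤-trans (term≤sum (f ∘ suc) i) (ℕP.m≤n+m _ _)

  sum-const : ∀ n c → ∑[ _ < n ] c ≡ n * c
  sum-const zero    c = refl
  sum-const (suc n) c = cong (_+_ c) (sum-const n c)

  length-filter-tabulate : ∀ {a p} {A : Set a} {P : Pred A p} (P? : Decidable P) {n} (f : Fin n → A) →
                           length (filter P? (tabulate f)) ≡ ∑[ i < n ] 𝟙 (P? (f i))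
  length-filter-tabulate P? {zero}  f = refl
  length-filter-tabulate P? {suc n} f with P? (f zero)
  ... | yes _ = cong suc (length-filter-tabulate P? (f ∘ suc))
  ... | no _  = length-filter-tabulate P? (f ∘ suc)

  fibreSize : ∀ {n} → (Fin n → ℕ) → ℕ → ℕ
  fibreSize {n} f i = ∑[ w < n ] 𝟙 (f w ≟ i)

  sum-by-fibres : ∀ {n} B (f : Fin n → ℕ) → (∀ w → f w < B) →
                  sum f ≡ ∑[ i < B ] (toℕ i * fibreSize f (toℕ i))
  sum-by-fibres {n} B f f<B = begin
    sum f                                          ≡⟨ sum-cong-≗ {n} (sym ∘ value-as-sum) ⟩
    ∑[ w < n ] ∑[ i < B ] (toℕ i * 𝟙 (f w ≟ toℕ i)) ≡⟨ ∑-comm {n} {B} (λ w i → toℕ i * 𝟙 (f w ≟ toℕ i)) ⟩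
    ∑[ i < B ] ∑[ w < n ] (toℕ i * 𝟙 (f w ≟ toℕ i)) ≡⟨ sum-cong-≗ {B} (λ i → sym (*-distribˡ-sum (toℕ i) (λ w → 𝟙 (f w ≟ toℕ i)))) ⟩
    ∑[ i < B ] (toℕ i * fibreSize f (toℕ i))       ∎
    where
    value-as-sum : ∀ w → ∑[ i < B ] (toℕ i * 𝟙 (f w ≟ toℕ i)) ≡ f w
    value-as-sum w = trans (sum-δ ℕP.+-0-commutativeMonoid _ i₀ off) on
      where
      i₀ = fromℕ< (f<B w)
      toℕ-i₀ : toℕ i₀ ≡ f w
      toℕ-i₀ = FinP.toℕ-fromℕ< (f<B w)
      off : ∀ j → j ≢ i₀ → toℕ j * 𝟙 (f w ≟ toℕ j) ≡ 0
      off j j≢i₀ = trans (cong (toℕ j *_) (𝟙-no (f w ≟ toℕ j) (λ e → j≢i₀ (FinP.toℕ-injective (trans (sym e) (sym toℕ-i₀))))))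
                         (ℕP.*-zeroʳ (toℕ j))
      on : toℕ i₀ * 𝟙 (f w ≟ toℕ i₀) ≡ f w
      on rewrite toℕ-i₀ = trans (cong (f w *_) (𝟙-yes (f w ≟ f w) refl)) (ℕP.*-identityʳ (f w))

  sum-cong-fibreSize : ∀ {n} (f g : Fin n → ℕ) → (∀ i → fibreSize f i ≡ fibreSize g i) → sum f ≡ sum g
  sum-cong-fibreSize f g same-fibres = begin
    sum f                                     ≡⟨ sum-by-fibres B f (below f (ℕP.m≤m+n (sum f) (sum g))) ⟩
    ∑[ i < B ] (toℕ i * fibreSize f (toℕ i))  ≡⟨ sum-cong-≗ {B} (λ i → cong (toℕ i *_) (same-fibres (toℕ i))) ⟩
    ∑[ i < B ] (toℕ i * fibreSize g (toℕ i))  ≡⟨ sym (sum-by-fibres B g (below g (ℕP.m≤n+m (sum g) (sum f)))) ⟩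
    sum g                                     ∎
    where
    B = suc (sum f + sum g)
    below : ∀ h → sum h ≤ sum f + sum g → ∀ w → h w < B
    below h bound w = s≤s (ℕP.≤-trans (term≤sum h w) bound)

  count-diagonal : ∀ {n} (d : Fin n → Fin n → ℕ) u i → count d u u i i ≡ fibreSize (d u) i
  count-diagonal {n} d u i =
    trans (length-filter-tabulate (λ w → (d u w ≟ i) ×-dec (d u w ≟ i)) id) (sum-cong-≗ {n} (λ w → 𝟙-×-dec-idem (d u w ≟ i)))
    where
    𝟙-×-dec-idem : ∀ {p} {P : Set p} (P? : Dec P) → 𝟙 (P? ×-dec P?) ≡ 𝟙 P?
    𝟙-×-dec-idem (yes _) = refl
    𝟙-×-dec-idem (no _)  = refl

  distanceRegular⇒transmissionRegular : ∀ {n} {d : Fin n → Fin n → ℕ} → (∀ u → d u u ≡ 0) →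
                                        DistanceRegular d → ∀ u v → sum (d u) ≡ sum (d v)
  distanceRegular⇒transmissionRegular {d = d} d-refl regular u v = sum-cong-fibreSize (d u) (d v) λ i → begin
    fibreSize (d u) i  ≡⟨ sym (count-diagonal d u i) ⟩
    count d u u i i    ≡⟨ regular u u v v (trans (d-refl u) (sym (d-refl v))) i i ⟩
    count d v v i i    ≡⟨ count-diagonal d v i ⟩
    fibreSize (d v) i  ∎

  -- π v w ≠ 0 means that w is the parent of v, one level closer to the root.
  module RootedOrientation {n} (A π : Fin n → Fin n → ℕ) (δ : Fin n → ℕ) (root : Fin n)
    (A-split : ∀ v w → A v w ≡ π v w + π w v)
    (π-level : ∀ v w → π v w * δ v ≡ π v w * suc (δ w))
    (unique-parent : ∀ v → sum (π v) + 𝟙 (v FinP.≟ root) ≡ 1)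
    (δ-root : δ root ≡ 0) where

    degree : Fin n → ℕ
    degree v = sum (A v)

    edges : ℕ
    edges = ∑[ v < n ] sum (π v)

    edges+1≡n : edges + 1 ≡ n
    edges+1≡n = begin
      edges + 1                                   ≡⟨ cong (_+_ edges) (sym root-count) ⟩
      edges + ∑[ v < n ] 𝟙 (v FinP.≟ root)        ≡⟨ sym (∑-distrib-+ (sum ∘ π) (λ v → 𝟙 (v FinP.≟ root))) ⟩
      ∑[ v < n ] (sum (π v) + 𝟙 (v FinP.≟ root))  ≡⟨ sum-cong-≗ {n} unique-parent ⟩
      ∑[ v < n ] 1                                ≡⟨ trans (sum-const n 1) (ℕP.*-identityʳ n) ⟩
      n                                           ∎
      where
      root-count : ∑[ v < n ] 𝟙 (v FinP.≟ root) ≡ 1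
      root-count = trans (sum-δ ℕP.+-0-commutativeMonoid (λ v → 𝟙 (v FinP.≟ root)) root (λ v → 𝟙-no (v FinP.≟ root)))
                         (𝟙-yes (root FinP.≟ root) refl)

    handshake : sum degree ≡ 2 * edges
    handshake = begin
      ∑[ v < n ] ∑[ w < n ] A v w                ≡⟨ sum-cong-≗ {n} (λ v → sum-cong-≗ {n} (A-split v)) ⟩
      ∑[ v < n ] ∑[ w < n ] (π v w + π w v)      ≡⟨ sum-cong-≗ {n} (λ v → ∑-distrib-+ (π v) (λ w → π w v)) ⟩
      ∑[ v < n ] (sum (π v) + ∑[ w < n ] π w v)  ≡⟨ ∑-distrib-+ (sum ∘ π) (λ v → ∑[ w < n ] π w v) ⟩
      edges + ∑[ v < n ] ∑[ w < n ] π w v        ≡⟨ cong (_+_ edges) (sym (∑-comm π)) ⟩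
      edges + edges                              ≡⟨ cong (_+_ edges) (sym (ℕP.+-identityʳ edges)) ⟩
      2 * edges                                  ∎

    parents*δ≡δ : ∀ v → sum (π v) * δ v ≡ δ v
    parents*δ≡δ v with v FinP.≟ root | unique-parent v
    ... | yes refl | _   = trans (cong (sum (π root) *_) δ-root) (trans (ℕP.*-zeroʳ (sum (π root))) (sym δ-root))
    ... | no _     | one = trans (cong (_* δ v) (trans (sym (ℕP.+-identityʳ _)) one)) (ℕP.*-identityˡ (δ v))

    sum-degree*δ : ∑[ v < n ] (degree v * δ v) + edges ≡ 2 * sum δ
    sum-degree*δ = begin
      ∑[ v < n ] (degree v * δ v) + edges     ≡⟨ cong (_+ edges) split ⟩
      child-depths + parent-depths + edges    ≡⟨ ℕP.+-assoc child-depths parent-depths edges ⟩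
      child-depths + (parent-depths + edges)  ≡⟨ cong (_+_ child-depths) parent-depths+edges ⟩
      child-depths + child-depths             ≡⟨ cong₂ _+_ child-depths≡sum child-depths≡sum ⟩
      sum δ + sum δ                           ≡⟨ cong (_+_ (sum δ)) (sym (ℕP.+-identityʳ (sum δ))) ⟩
      2 * sum δ                               ∎
      where
      child-depths parent-depths : ℕ
      child-depths  = ∑[ v < n ] ∑[ w < n ] (π v w * δ v)
      parent-depths = ∑[ v < n ] ∑[ w < n ] (π v w * δ w)

      split : ∑[ v < n ] (degree v * δ v) ≡ child-depths + parent-depths
      split = begin
        ∑[ v < n ] (degree v * δ v)
          ≡⟨ sum-cong-≗ {n} (λ v → cong (_* δ v) (sum-cong-≗ {n} (A-split v))) ⟩
        ∑[ v < n ] (∑[ w < n ] (π v w + π w v) * δ v)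
          ≡⟨ sum-cong-≗ {n} (λ v → *-distribʳ-sum (δ v) (λ w → π v w + π w v)) ⟩
        ∑[ v < n ] ∑[ w < n ] ((π v w + π w v) * δ v)
          ≡⟨ sum-cong-≗ {n} (λ v → sum-cong-≗ {n} (λ w → ℕP.*-distribʳ-+ (δ v) (π v w) (π w v))) ⟩
        ∑[ v < n ] ∑[ w < n ] (π v w * δ v + π w v * δ v)
          ≡⟨ sum-cong-≗ {n} (λ v → ∑-distrib-+ (λ w → π v w * δ v) (λ w → π w v * δ v)) ⟩
        ∑[ v < n ] (∑[ w < n ] (π v w * δ v) + ∑[ w < n ] (π w v * δ v))
          ≡⟨ ∑-distrib-+ (λ v → ∑[ w < n ] (π v w * δ v)) (λ v → ∑[ w < n ] (π w v * δ v)) ⟩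
        child-depths + ∑[ v < n ] ∑[ w < n ] (π w v * δ v)
          ≡⟨ cong (_+_ child-depths) (sym (∑-comm (λ w v → π w v * δ v))) ⟩
        child-depths + parent-depths
          ∎

      parent-depths+edges : parent-depths + edges ≡ child-depths
      parent-depths+edges = begin
        parent-depths + edges
          ≡⟨ sym (∑-distrib-+ (λ v → ∑[ w < n ] (π v w * δ w)) (sum ∘ π)) ⟩
        ∑[ v < n ] (∑[ w < n ] (π v w * δ w) + sum (π v))
          ≡⟨ sum-cong-≗ {n} (λ v → sym (∑-distrib-+ (λ w → π v w * δ w) (π v))) ⟩
        ∑[ v < n ] ∑[ w < n ] (π v w * δ w + π v w)
          ≡⟨ sum-cong-≗ {n} (λ v → sum-cong-≗ {n} (λ w → one-level-down v w)) ⟩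
        child-depths
          ∎
        where
        one-level-down : ∀ v w → π v w * δ w + π v w ≡ π v w * δ v
        one-level-down v w =
          trans (ℕP.+-comm (π v w * δ w) (π v w)) (trans (sym (ℕP.*-suc (π v w) (δ w))) (sym (π-level v w)))

      child-depths≡sum : child-depths ≡ sum δ
      child-depths≡sum = trans (sum-cong-≗ {n} (λ v → sym (*-distribʳ-sum (δ v) (π v)))) (sum-cong-≗ {n} parents*δ≡δ)

module _ {a} {A : Set a} where

  All-∷ʳ : ∀ {p} {P : A → Set p} {k} {xs : Vec A k} {y} → All P xs → P y → All P (xs ∷ʳ y)
  All-∷ʳ []         py = py ∷ []
  All-∷ʳ (px ∷ pxs) py = px ∷ All-∷ʳ pxs py

  All-∷ʳ⁻ : ∀ {p} {P : A → Set p} {k} (xs : Vec A k) {y} → All P (xs ∷ʳ y) → P y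
  All-∷ʳ⁻ []       (py ∷ [])  = py
  All-∷ʳ⁻ (_ ∷ xs) (_ ∷ pxs) = All-∷ʳ⁻ xs pxs

  Unique-∷ʳ : ∀ {k} {xs : Vec A k} {y} → Unique xs → All (_≢ y) xs → Unique (xs ∷ʳ y)
  Unique-∷ʳ []           []           = [] ∷ []
  Unique-∷ʳ (x∉ ∷ uniq) (x≢y ∷ xs≢y) = All-∷ʳ x∉ x≢y ∷ Unique-∷ʳ uniq xs≢y

  lookup-∷ʳ-last : ∀ {k} (xs : Vec A k) y → lookup (xs ∷ʳ y) (Fin.fromℕ k) ≡ y
  lookup-∷ʳ-last []       y = refl
  lookup-∷ʳ-last (_ ∷ xs) y = lookup-∷ʳ-last xs y

  module _ {ℓ} {R : Rel A ℓ} where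

    Linked-∷ʳ : ∀ {k} (xs : Vec A k) {x y} → Linked R (xs ∷ʳ x) → R x y → Linked R ((xs ∷ʳ x) ∷ʳ y)
    Linked-∷ʳ []           [-]       r = r ∷ [-]
    Linked-∷ʳ (_ ∷ [])     (r′ ∷ rs) r = r′ ∷ Linked-∷ʳ [] rs r
    Linked-∷ʳ (_ ∷ z ∷ zs) (r′ ∷ rs) r = r′ ∷ Linked-∷ʳ (z ∷ zs) rs r

    Linked-lookup : ∀ {k} {xs : Vec A (suc k)} → Linked R xs → ∀ i → R (lookup xs (inject₁ i)) (lookup xs (suc i))
    Linked-lookup {xs = _ ∷ _ ∷ _} (r ∷ _)  zero    = r
    Linked-lookup {xs = _ ∷ _ ∷ _} (_ ∷ rs) (suc i) = Linked-lookup rs i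

module _ {n} (G : Graph n) where

  Adj-sym : ∀ {u v} → Adj G u v → Adj G v u
  Adj-sym {u} {v} uv = trans (Graph.sym G v u) uv

  Adj⇒≢ : ∀ {u v} → Adj G u v → u ≢ v
  Adj⇒≢ {u} uu refl with trans (sym uu) (irrefl G u)
  ... | ()

  Adj? : ∀ u v → Dec (Adj G u v)
  Adj? u v = adj G u v BoolP.≟ true

  adjacency : Fin n → Fin n → ℕ
  adjacency u v = 𝟙 (Adj? u v)

  degree : Fin n → ℕ
  degree v = ℕΣ.sum (adjacency v)

  HasCycle-intro : ∀ {k} (c : Vec (Fin n) (suc (suc k))) z →
                   Unique (c ∷ʳ z) → Linked (Adj G) (c ∷ʳ z) → Adj G z (head c) → HasCycle G
  HasCycle-intro {k} c@(_ ∷ _) z uniq linked closing =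
    k , lookup (c ∷ʳ z) , lookup-injective uniq _ _ , Linked-lookup linked ,
    subst (λ x → Adj G x (head c)) (sym (lookup-∷ʳ-last c z)) closing

module _ {n} {G : Graph n} where

  Walk-snoc : ∀ {u v w k} → Walk G u v k → Adj G v w → Walk G u w (suc k)
  Walk-snoc nil          vw = cons vw nil
  Walk-snoc (cons uu′ p) vw = cons uu′ (Walk-snoc p vw)

  Walk-reverse : ∀ {u v k} → Walk G u v k → Walk G v u k
  Walk-reverse nil         = nil
  Walk-reverse (cons uw p) = Walk-snoc (Walk-reverse p) (Adj-sym G uw)

module ShortestPaths {n} {G : Graph n} {d : Fin n → Fin n → ℕ} (isd : IsDistance G d) where
  open Data.Nat using (_≤_; s≤s)

  d-minimal : ∀ {u v k} → Walk G u v k → d u v ≤ k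
  d-minimal {u} {v} = proj₂ (isd u v) _

  d-sym : ∀ u v → d u v ≡ d v u
  d-sym u v = ℕP.≤-antisym (d-minimal (Walk-reverse (proj₁ (isd v u)))) (d-minimal (Walk-reverse (proj₁ (isd u v))))

  d-refl : ∀ u → d u u ≡ 0
  d-refl u = ℕP.n≤0⇒n≡0 (d-minimal nil)

  d≡0⇒≡ : ∀ {u v} → d u v ≡ 0 → u ≡ v
  d≡0⇒≡ {u} {v} uv≡0 = walk₀ (subst (Walk G u v) uv≡0 (proj₁ (isd u v)))
    where
    walk₀ : ∀ {x y} → Walk G x y 0 → x ≡ y
    walk₀ nil = refl

  d-adj : ∀ {u v w} → Adj G u w → d u v ≤ suc (d w v)
  d-adj {v = v} {w} uw = d-minimal (cons uw (proj₁ (isd w v)))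

  closer-neighbour : ∀ {v u} → v ≢ u → ∃ λ w → Adj G v w × d v u ≡ suc (d w u)
  closer-neighbour {v} {u} v≢u = along (proj₁ (isd v u)) refl v≢u
    where
    along : ∀ {x k} → Walk G x u k → d x u ≡ k → x ≢ u → ∃ λ w → Adj G x w × d x u ≡ suc (d w u)
    along nil                 _   x≢u = ⊥-elim (x≢u refl)
    along (cons {w = w} xw p) xu≡ _   =
      w , xw , ℕP.≤-antisym (d-adj xw) (subst (suc (d w u) ℕ.≤_) (sym xu≡) (s≤s (d-minimal p)))

no-2-cycle : ∀ {a b : ℕ} → a ≡ suc b → b ≢ suc a
no-2-cycle refl ()

module TreeLevels {n} {G : Graph n} {d : Fin n → Fin n → ℕ} (isd : IsDistance G d)
                  (acyclic : ¬ HasCycle G) (root : Fin n) where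
  open Data.Nat using (_≤_; _*_; _+_; _≟_)
  open ShortestPaths isd

  depth : Fin n → ℕ
  depth v = d v root

  private
    deep⇒≢root : ∀ {v k} → depth v ≡ suc k → v ≢ root
    deep⇒≢root v≡ refl = ℕP.1+n≢0 (trans (sym v≡) (d-refl root))

    shallower-∉ : ∀ {k x ℓ} {xs : Vec (Fin n) ℓ} → depth x ≡ k → All (λ y → suc k ≤ depth y) xs → All (x ≢_) xs
    shallower-∉ x≡k = All.map (λ k<y x≡y → ℕP.<-irrefl (trans (sym x≡k) (cong depth x≡y)) k<y)

  -- Replace both ends by their parents until these coincide, which closes a cycle; they must
  -- coincide before reaching the root, since the ends stay distinct.
  no-level-path : ∀ k {ℓ} a b (mid : Vec (Fin n) ℓ) → depth a ≡ k → depth b ≡ k →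
                  All (λ x → k ≤ depth x) ((a ∷ mid) ∷ʳ b) → Unique ((a ∷ mid) ∷ʳ b) →
                  Linked (Adj G) ((a ∷ mid) ∷ʳ b) → ⊥
  no-level-path zero a b mid a≡0 b≡0 _ (a∉ ∷ _) _ = All-∷ʳ⁻ mid a∉ (trans (d≡0⇒≡ a≡0) (sym (d≡0⇒≡ b≡0)))
  no-level-path (suc k) a b mid a≡ b≡ deep uniq linked
    with closer-neighbour (deep⇒≢root a≡) | closer-neighbour (deep⇒≢root b≡)
  ... | a′ , aa′ , a≡a′ | b′ , bb′ , b≡b′ =
    climb (ℕP.suc-injective (trans (sym a≡a′) a≡)) (ℕP.suc-injective (trans (sym b≡b′) b≡)) (a′ FinP.≟ b′)
    where
    climb : depth a′ ≡ k → depth b′ ≡ k → Dec (a′ ≡ b′) → ⊥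
    climb a′≡k _ (yes refl) =
      acyclic (HasCycle-intro G (a′ ∷ a ∷ mid) b (shallower-∉ a′≡k deep ∷ uniq) (Adj-sym G aa′ ∷ linked) bb′)
    climb a′≡k b′≡k (no a′≢b′) = no-level-path k a′ b′ ((a ∷ mid) ∷ʳ b) a′≡k b′≡k
      (ℕP.≤-reflexive (sym a′≡k) ∷ All-∷ʳ (All.map ℕP.<⇒≤ deep) (ℕP.≤-reflexive (sym b′≡k)))
      (All-∷ʳ (shallower-∉ a′≡k deep) a′≢b′ ∷ Unique-∷ʳ uniq (All.map ≢-sym (shallower-∉ b′≡k deep)))
      (Adj-sym G aa′ ∷ Linked-∷ʳ (a ∷ mid) linked bb′)

  no-level-edge : ∀ {v w} → Adj G v w → depth v ≢ depth w
  no-level-edge {v} {w} vw v≡w = no-level-path (depth v) v w [] refl (sym v≡w)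
    (ℕP.≤-refl ∷ ℕP.≤-reflexive v≡w ∷ [])
    ((Adj⇒≢ G vw ∷ []) ∷ [] ∷ [])
    (vw ∷ [-])

  parent-unique : ∀ {v w₁ w₂} → Adj G v w₁ → Adj G v w₂ →
                  depth v ≡ suc (depth w₁) → depth v ≡ suc (depth w₂) → w₁ ≡ w₂
  parent-unique {v} {w₁} {w₂} vw₁ vw₂ v≡w₁ v≡w₂ with w₁ FinP.≟ w₂
  ... | yes w₁≡w₂ = w₁≡w₂
  ... | no w₁≢w₂  = ⊥-elim (no-level-path (depth w₁) w₁ w₂ (v ∷ []) refl w₂≡w₁
    (ℕP.≤-refl ∷ ℕP.≤-trans (ℕP.n≤1+n _) (ℕP.≤-reflexive (sym v≡w₁)) ∷ ℕP.≤-reflexive (sym w₂≡w₁) ∷ [])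
    ((Adj⇒≢ G (Adj-sym G vw₁) ∷ w₁≢w₂ ∷ []) ∷ (Adj⇒≢ G vw₂ ∷ []) ∷ [] ∷ [])
    (Adj-sym G vw₁ ∷ vw₂ ∷ [-]))
    where
    w₂≡w₁ : depth w₂ ≡ depth w₁
    w₂≡w₁ = ℕP.suc-injective (trans (sym v≡w₂) v≡w₁)

  adjacent-levels : ∀ {v w} → Adj G v w → depth v ≡ suc (depth w) ⊎ depth w ≡ suc (depth v)
  adjacent-levels {v} {w} vw with ℕP.<-cmp (depth v) (depth w)
  ... | tri< v<w _ _ = inj₂ (ℕP.≤-antisym (d-adj (Adj-sym G vw)) v<w)
  ... | tri≈ _ v≡w _ = ⊥-elim (no-level-edge vw v≡w)
  ... | tri> _ _ w<v = inj₁ (ℕP.≤-antisym (d-adj vw) w<v)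

  parent? : ∀ v w → Dec (Adj G v w × depth v ≡ suc (depth w))
  parent? v w = Adj? G v w ×-dec (depth v ≟ suc (depth w))

  π : Fin n → Fin n → ℕ
  π v w = 𝟙 (parent? v w)

  π-level : ∀ v w → π v w * depth v ≡ π v w * suc (depth w)
  π-level v w with parent? v w
  ... | yes (_ , v≡) = cong (1 *_) v≡
  ... | no _         = refl

  adjacency-split : ∀ v w → adjacency G v w ≡ π v w + π w v
  adjacency-split v w = by-cases (Adj? G v w)
    where
    by-cases : Dec (Adj G v w) → adjacency G v w ≡ π v w + π w v
    by-cases (no ¬vw) = trans (𝟙-no (Adj? G v w) ¬vw)
      (sym (cong₂ _+_ (𝟙-no (parent? v w) (¬vw ∘ proj₁)) (𝟙-no (parent? w v) (¬vw ∘ Adj-sym G ∘ proj₁))))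
    by-cases (yes vw) with adjacent-levels vw
    ... | inj₁ v≡ = trans (𝟙-yes (Adj? G v w) vw)
      (sym (cong₂ _+_ (𝟙-yes (parent? v w) (vw , v≡)) (𝟙-no (parent? w v) (no-2-cycle v≡ ∘ proj₂))))
    ... | inj₂ w≡ = trans (𝟙-yes (Adj? G v w) vw)
      (sym (cong₂ _+_ (𝟙-no (parent? v w) (no-2-cycle w≡ ∘ proj₂)) (𝟙-yes (parent? w v) (Adj-sym G vw , w≡))))

  unique-parent : ∀ v → ℕΣ.sum (π v) + 𝟙 (v FinP.≟ root) ≡ 1
  unique-parent v with v FinP.≟ root
  ... | yes refl = cong (_+ 1) (trans (ℕΣ.sum-cong-≗ {n} root-orphan) (ℕΣ.sum-replicate-zero n))
    where
    root-orphan : ∀ w → π root w ≡ 0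
    root-orphan w = 𝟙-no (parent? root w) (λ (_ , root≡) → ℕP.1+n≢0 (trans (sym root≡) (d-refl root)))
  ... | no v≢root with closer-neighbour v≢root
  ...   | p , vp , v≡p =
    trans (ℕP.+-identityʳ _) (trans (sum-δ ℕP.+-0-commutativeMonoid (π v) p other) (𝟙-yes (parent? v p) (vp , v≡p)))
    where
    other : ∀ w → w ≢ p → π v w ≡ 0
    other w w≢p = 𝟙-no (parent? v w) (λ (vw , v≡w) → w≢p (parent-unique vw vp v≡w v≡p))

  open RootedOrientation (adjacency G) π depth root adjacency-split π-level unique-parent (d-refl root) public
    using (edges; edges+1≡n; handshake; sum-degree*δ)

module _ where
  open Data.Rational using (_+_; _*_; _/_)

  fromℚᵘ-homo-+ : ∀ p q → fromℚᵘ (p ℚᵘ.+ q) ≡ fromℚᵘ p + fromℚᵘ q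
  fromℚᵘ-homo-+ p q = ℚP.toℚᵘ-injective (ℚᵘP.≃-trans (ℚP.toℚᵘ-fromℚᵘ (p ℚᵘ.+ q)) (ℚᵘP.≃-sym
    (ℚᵘP.≃-trans (ℚP.toℚᵘ-homo-+ (fromℚᵘ p) (fromℚᵘ q)) (ℚᵘP.+-cong (ℚP.toℚᵘ-fromℚᵘ p) (ℚP.toℚᵘ-fromℚᵘ q)))))

  fromℚᵘ-homo-* : ∀ p q → fromℚᵘ (p ℚᵘ.* q) ≡ fromℚᵘ p * fromℚᵘ q
  fromℚᵘ-homo-* p q = ℚP.toℚᵘ-injective (ℚᵘP.≃-trans (ℚP.toℚᵘ-fromℚᵘ (p ℚᵘ.* q)) (ℚᵘP.≃-sym
    (ℚᵘP.≃-trans (ℚP.toℚᵘ-homo-* (fromℚᵘ p) (fromℚᵘ q)) (ℚᵘP.*-cong (ℚP.toℚᵘ-fromℚᵘ p) (ℚP.toℚᵘ-fromℚᵘ q)))))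

  fromℕ : ℕ → ℚ
  fromℕ a = + a / 1

  fromℕ-+ : ∀ a b → fromℕ (a ℕ.+ b) ≡ fromℕ a + fromℕ b
  fromℕ-+ a b = trans (ℚP.fromℚᵘ-cong {mkℚᵘ (+ (a ℕ.+ b)) 0} {mkℚᵘ (+ a) 0 ℚᵘ.+ mkℚᵘ (+ b) 0} (*≡* numerators))
                      (fromℚᵘ-homo-+ (mkℚᵘ (+ a) 0) (mkℚᵘ (+ b) 0))
    where
    over-1 : ∀ x y → (x ℤ.+ y) ℤ.* + 1 ≡ (x ℤ.* + 1 ℤ.+ y ℤ.* + 1) ℤ.* + 1
    over-1 = solve-∀
    numerators : + (a ℕ.+ b) ℤ.* + 1 ≡ (+ a ℤ.* + 1 ℤ.+ + b ℤ.* + 1) ℤ.* + 1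
    numerators = trans (cong (ℤ._* + 1) (ℤP.pos-+ a b)) (over-1 (+ a) (+ b))

  fromℕ-* : ∀ a b → fromℕ (a ℕ.* b) ≡ fromℕ a * fromℕ b
  fromℕ-* a b = trans (ℚP.fromℚᵘ-cong {mkℚᵘ (+ (a ℕ.* b)) 0} {mkℚᵘ (+ a) 0 ℚᵘ.* mkℚᵘ (+ b) 0}
                                      (*≡* (cong (ℤ._* + 1) (ℤP.pos-* a b))))
                      (fromℚᵘ-homo-* (mkℚᵘ (+ a) 0) (mkℚᵘ (+ b) 0))

  /-suc : ∀ a b → + a / suc b ≡ fromℕ a * (+ 1 / suc b)
  /-suc a b = trans (ℚP.fromℚᵘ-cong {mkℚᵘ (+ a) b} {mkℚᵘ (+ a) 0 ℚᵘ.* mkℚᵘ (+ 1) b}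
                      (*≡* (sym (cong₂ ℤ._*_ (ℤP.*-identityʳ (+ a)) (cong (λ k → + suc k) (sym (ℕP.+-identityʳ b)))))))
                    (fromℚᵘ-homo-* (mkℚᵘ (+ a) 0) (mkℚᵘ (+ 1) b))

  1/-* : ∀ a b → + 1 / (suc a ℕ.* suc b) ≡ (+ 1 / suc a) * (+ 1 / suc b)
  1/-* a b = fromℚᵘ-homo-* (mkℚᵘ (+ 1) a) (mkℚᵘ (+ 1) b)

  fromℕ-*-1/ : ∀ b → fromℕ (suc b) * (+ 1 / suc b) ≡ 1ℚ
  fromℕ-*-1/ b = trans (sym (/-suc (suc b) b))
                       (ℚP.fromℚᵘ-cong {mkℚᵘ (+ suc b) b} {mkℚᵘ (+ 1) 0} (*≡* (ℤP.*-comm (+ suc b) (+ 1))))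

  /≡0⇒≡0 : ∀ {a b} → + a / suc b ≡ 0ℚ → a ≡ 0
  /≡0⇒≡0 {zero}      _     = refl
  /≡0⇒≡0 {suc a} {b} a/b≡0 =
    ⊥-elim (ℤ.Positive.pos (subst Data.Rational.Positive a/b≡0 (ℚP.normalize-pos (suc a) (suc b))))

module _ where
  open Data.Rational using (_+_; _*_; 1/_)
  open ℚΣ
  open ≡-Reasoning

  sumFin≡sum : ∀ {n} (f : Fin n → ℚ) → sumFin f ≡ sum f
  sumFin≡sum {zero}  f = refl
  sumFin≡sum {suc n} f = cong (_+_ (f zero)) (sumFin≡sum (f ∘ suc))

  fromℕ-sum : ∀ {n} (f : Fin n → ℕ) → fromℕ (ℕΣ.sum f) ≡ sum (fromℕ ∘ f)
  fromℕ-sum {zero}  f = refl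
  fromℕ-sum {suc n} f = trans (fromℕ-+ (f zero) _) (cong (_+_ (fromℕ (f zero))) (fromℕ-sum (f ∘ suc)))

  sum-constℚ : ∀ n q → ∑[ _ < n ] q ≡ fromℕ n * q
  sum-constℚ zero    q = sym (ℚP.*-zeroˡ q)
  sum-constℚ (suc n) q = begin
    q + ∑[ _ < n ] q      ≡⟨ cong (_+_ q) (sum-constℚ n q) ⟩
    q + fromℕ n * q       ≡⟨ cong (_+ fromℕ n * q) (sym (ℚP.*-identityˡ q)) ⟩
    1ℚ * q + fromℕ n * q  ≡⟨ sym (ℚP.*-distribʳ-+ q 1ℚ (fromℕ n)) ⟩
    (1ℚ + fromℕ n) * q    ≡⟨ cong (_* q) (sym (fromℕ-+ 1 n)) ⟩
    fromℕ (suc n) * q     ∎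

  sum-scaled : ∀ {n} a (x : Fin n → ℚ) → sumFin (λ j → a * x j) ≡ a * sumFin x
  sum-scaled a x = trans (sumFin≡sum (λ j → a * x j)) (trans (sym (*-distribˡ-sum a x)) (cong (a *_) (sym (sumFin≡sum x))))

  D·≡sum : ∀ {n} (d : Fin n → Fin n → ℕ) x i → (D· d) x i ≡ ∑[ j < n ] (fromℕ (d i j) * x j)
  D·≡sum d x i = sumFin≡sum (λ j → fromℕ (d i j) * x j)

  D·-scale : ∀ {n} (d : Fin n → Fin n → ℕ) a x i → (D· d) (λ j → a * x j) i ≡ a * (D· d) x i
  D·-scale {n} d a x i = begin
    (D· d) (λ j → a * x j) i                ≡⟨ D·≡sum d (λ j → a * x j) i ⟩
    ∑[ j < n ] (fromℕ (d i j) * (a * x j))  ≡⟨ sum-cong-≗ {n} (λ j → rearrange (fromℕ (d i j)) (x j)) ⟩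
    ∑[ j < n ] (a * (fromℕ (d i j) * x j))  ≡⟨ sym (*-distribˡ-sum a (λ j → fromℕ (d i j) * x j)) ⟩
    a * ∑[ j < n ] (fromℕ (d i j) * x j)    ≡⟨ cong (a *_) (sym (D·≡sum d x i)) ⟩
    a * (D· d) x i                          ∎
    where
    open +-*-Solver
    rearrange : ∀ e y → e * (a * y) ≡ a * (e * y)
    rearrange = solve 3 (λ a e y → e :* (a :* y) := a :* (e :* y)) refl a

  sum-affine-const : ∀ {n} {x z : Fin n → ℚ} {c} → sumFin x ≡ 1ℚ → (∀ i → z i ≡ c) → ∑[ i < n ] (x i * z i) ≡ c
  sum-affine-const {n} {x} {z} {c} Σx≡1 z≡c = begin
    ∑[ i < n ] (x i * z i)  ≡⟨ sum-cong-≗ {n} (λ i → cong (x i *_) (z≡c i)) ⟩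
    ∑[ i < n ] (x i * c)    ≡⟨ sym (*-distribʳ-sum c x) ⟩
    sum x * c               ≡⟨ cong (_* c) (trans (sym (sumFin≡sum x)) Σx≡1) ⟩
    1ℚ * c                  ≡⟨ ℚP.*-identityˡ c ⟩
    c                       ∎

  module _ {n} {d : Fin n → Fin n → ℕ} (d-sym : ∀ u v → d u v ≡ d v u) where

    D·-self-adjoint : ∀ x y → ∑[ i < n ] (x i * (D· d) y i) ≡ ∑[ j < n ] (y j * (D· d) x j)
    D·-self-adjoint x y = begin
      ∑[ i < n ] (x i * (D· d) y i)                        ≡⟨ sum-cong-≗ {n} (λ i → cong (x i *_) (D·≡sum d y i)) ⟩
      ∑[ i < n ] (x i * ∑[ j < n ] (fromℕ (d i j) * y j))  ≡⟨ sum-cong-≗ {n} (λ i → *-distribˡ-sum (x i) (λ j → fromℕ (d i j) * y j)) ⟩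
      ∑[ i < n ] ∑[ j < n ] (x i * (fromℕ (d i j) * y j))  ≡⟨ ∑-comm {n} {n} (λ i j → x i * (fromℕ (d i j) * y j)) ⟩
      ∑[ j < n ] ∑[ i < n ] (x i * (fromℕ (d i j) * y j))  ≡⟨ sum-cong-≗ {n} (λ j → sum-cong-≗ {n} (λ i → transpose i j)) ⟩
      ∑[ j < n ] ∑[ i < n ] (y j * (fromℕ (d j i) * x i))  ≡⟨ sum-cong-≗ {n} (λ j → sym (*-distribˡ-sum (y j) (λ i → fromℕ (d j i) * x i))) ⟩
      ∑[ j < n ] (y j * ∑[ i < n ] (fromℕ (d j i) * x i))  ≡⟨ sum-cong-≗ {n} (λ j → cong (y j *_) (sym (D·≡sum d x j))) ⟩
      ∑[ j < n ] (y j * (D· d) x j)                        ∎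
      where
      open +-*-Solver
      transpose : ∀ i j → x i * (fromℕ (d i j) * y j) ≡ y j * (fromℕ (d j i) * x i)
      transpose i j rewrite d-sym i j =
        solve 3 (λ a b c → a :* (b :* c) := c :* (b :* a)) refl (x i) (fromℕ (d j i)) (y j)

    InX-unique : ∀ {c t} → InX d (λ _ → c) → InX d (λ _ → t) → t ≡ c
    InX-unique (x , Σx≡1 , Dx≡c) (y , Σy≡1 , Dy≡t) =
      trans (sym (sum-affine-const Σx≡1 Dy≡t)) (trans (D·-self-adjoint x y) (sum-affine-const Σy≡1 Dx≡c))

  InX⇒FiniteCase : ∀ {n} {d : Fin n → Fin n → ℕ} {c} → InX d (λ _ → c) → c ≢ 0ℚ → FiniteCase d
  InX⇒FiniteCase {d = d} {c} (x , Σx≡1 , Dx≡c) c≢0 = inj₂ (potential , is-potential , Σpotential≢0)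
    where
    instance
      _ = Data.Rational.≢-nonZero c≢0
    potential = λ j → 1/ c * x j
    is-potential : CurvaturePotential d potential
    is-potential i = trans (D·-scale d (1/ c) x i) (trans (cong (1/ c *_) (Dx≡c i)) (ℚP.*-inverseˡ c))
    Σpotential≢0 : sumFin potential ≢ 0ℚ
    Σpotential≢0 Σ≡0 = ℚP.1≢0 (begin
      1ℚ                     ≡⟨ sym (ℚP.*-inverseʳ c) ⟩
      c * 1/ c               ≡⟨ cong (c *_) (sym (ℚP.*-identityʳ (1/ c))) ⟩
      c * (1/ c * 1ℚ)        ≡⟨ cong (λ s → c * (1/ c * s)) (sym Σx≡1) ⟩
      c * (1/ c * sumFin x)  ≡⟨ cong (c *_) (trans (sym (sum-scaled (1/ c) x)) Σ≡0) ⟩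
      c * 0ℚ                 ≡⟨ ℚP.*-zeroʳ c ⟩
      0ℚ                     ∎)

  zero-row⇒DistanceExceptional : ∀ {n} {d : Fin n → Fin n → ℕ} i → (∀ j → d i j ≡ 0) → DistanceExceptional d
  zero-row⇒DistanceExceptional {n} {d} i row≡0 (x , potential) = ℚP.1≢0 (begin
    1ℚ                                ≡⟨ sym (potential i) ⟩
    (D· d) x i                        ≡⟨ D·≡sum d x i ⟩
    ∑[ j < n ] (fromℕ (d i j) * x j)  ≡⟨ sum-cong-≗ {n} (λ j → trans (cong (λ k → fromℕ k * x j) (row≡0 j)) (ℚP.*-zeroˡ (x j))) ⟩
    ∑[ j < n ] 0ℚ                     ≡⟨ sum-replicate-zero n ⟩
    0ℚ                                ∎)

FiniteCase-intro : ∀ {m c} {d : Fin (suc m) → Fin (suc m) → ℕ} → d zero zero ≡ 0 →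
                   InX d (λ _ → c) → (c ≡ 0ℚ → m ≡ 0) → FiniteCase d
FiniteCase-intro {c = c} {d = d} d₀₀≡0 inX c≡0⇒m≡0 with c ℚP.≟ 0ℚ
... | no c≢0 = InX⇒FiniteCase {d = d} inX c≢0
... | yes c≡0 with c≡0⇒m≡0 c≡0
...   | refl = inj₁ (zero-row⇒DistanceExceptional {d = d} zero λ { zero → d₀₀≡0 })

CurvatureIndex-intro : ∀ {m c} {d : Fin (suc m) → Fin (suc m) → ℕ} → (∀ u v → d u v ≡ d v u) → d zero zero ≡ 0 →
                       InX d (λ _ → c) → (c ≡ 0ℚ → m ≡ 0) → CurvatureIndex d (fin c)
CurvatureIndex-intro {d = d} d-sym d₀₀≡0 inX c≡0⇒m≡0 =
  FiniteCase-intro {d = d} d₀₀≡0 inX c≡0⇒m≡0 , inX , λ _ → InX-unique d-sym inX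

module _ {m} {d : Fin (suc m) → Fin (suc m) → ℕ} {r} (transmission : ∀ u → ℕΣ.sum (d u) ≡ r) where
  open Data.Rational using (_+_; _*_; _/_)
  open ℚΣ
  open ≡-Reasoning

  private
    n = suc m
    1/n = + 1 / n

  fromℕ-row-sum : ∀ u → ∑[ v < n ] fromℕ (d u v) ≡ fromℕ r
  fromℕ-row-sum u = trans (sym (fromℕ-sum (d u))) (cong fromℕ (transmission u))

  transmissionRegular⇒InX : InX d (λ _ → + r / n)
  transmissionRegular⇒InX = (λ _ → 1/n) , Σ≡1 , D·≡
    where
    Σ≡1 : sumFin {n} (λ _ → 1/n) ≡ 1ℚ
    Σ≡1 = trans (sumFin≡sum {n} (λ _ → 1/n)) (trans (sum-constℚ n 1/n) (fromℕ-*-1/ m))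
    D·≡ : ∀ u → (D· d) (λ _ → 1/n) u ≡ + r / n
    D·≡ u = begin
      (D· d) (λ _ → 1/n) u              ≡⟨ D·≡sum d (λ _ → 1/n) u ⟩
      ∑[ v < n ] (fromℕ (d u v) * 1/n)  ≡⟨ sym (*-distribʳ-sum 1/n (λ v → fromℕ (d u v))) ⟩
      ∑[ v < n ] fromℕ (d u v) * 1/n    ≡⟨ cong (_* 1/n) (fromℕ-row-sum u) ⟩
      fromℕ r * 1/n                     ≡⟨ sym (/-suc r m) ⟩
      + r / n                           ∎

  wiener-transmission : (+ 2 / 1) * Wiener d * (+ 1 / (n ℕ.* n)) ≡ + r / n
  wiener-transmission = begin
    (+ 2 / 1) * (½ * sumFin (λ u → sumFin (λ v → fromℕ (d u v)))) * (+ 1 / (n ℕ.* n))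
      ≡⟨ cong₂ (λ s t → (+ 2 / 1) * (½ * s) * t) double-sum (1/-* m m) ⟩
    (+ 2 / 1) * (½ * (fromℕ n * fromℕ r)) * (1/n * 1/n)
      ≡⟨ solve 3 (λ N R q → con (+ 2 / 1) :* (con ½ :* (N :* R)) :* (q :* q) := (N :* q) :* (R :* q)) refl (fromℕ n) (fromℕ r) 1/n ⟩
    (fromℕ n * 1/n) * (fromℕ r * 1/n)
      ≡⟨ cong (_* (fromℕ r * 1/n)) (fromℕ-*-1/ m) ⟩
    1ℚ * (fromℕ r * 1/n)
      ≡⟨ trans (ℚP.*-identityˡ _) (sym (/-suc r m)) ⟩
    + r / n
      ∎
    where
    open +-*-Solver
    ½ = + 1 / 2
    double-sum : sumFin (λ u → sumFin (λ v → fromℕ (d u v))) ≡ fromℕ n * fromℕ r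
    double-sum = begin
      sumFin (λ u → sumFin (λ v → fromℕ (d u v)))  ≡⟨ sumFin≡sum (λ u → sumFin (λ v → fromℕ (d u v))) ⟩
      ∑[ u < n ] sumFin (λ v → fromℕ (d u v))      ≡⟨ sum-cong-≗ {n} (λ u → trans (sumFin≡sum (λ v → fromℕ (d u v))) (fromℕ-row-sum u)) ⟩
      ∑[ u < n ] fromℕ r                           ≡⟨ sum-constℚ n (fromℕ r) ⟩
      fromℕ n * fromℕ r                            ∎

zero-transmission⇒single-vertex : ∀ {m} {G : Graph (suc m)} {d} → IsDistance G d → ℕΣ.sum (d zero) ≡ 0 → m ≡ 0
zero-transmission⇒single-vertex {zero}          _   _     = refl
zero-transmission⇒single-vertex {suc _} {d = d} isd sum≡0
  with d≡0⇒≡ (ℕP.n≤0⇒n≡0 (subst (d zero (suc zero) ℕ.≤_) sum≡0 (term≤sum (d zero) (suc zero))))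
  where open ShortestPaths isd
... | ()

module _ {m} {G : Graph (suc m)} {d : Fin (suc m) → Fin (suc m) → ℕ} (isd : IsDistance G d) (acyclic : ¬ HasCycle G) where
  open Data.Rational using (_+_; _*_; _/_; _-_; -_)
  open ℚΣ
  open ShortestPaths isd
  open +-*-Solver
  open ≡-Reasoning

  private
    n = suc m
    ½ = + 1 / 2

    edges≡m : ∀ root → TreeLevels.edges isd acyclic root ≡ m
    edges≡m root = ℕP.suc-injective (trans (ℕP.+-comm 1 _) (TreeLevels.edges+1≡n isd acyclic root))

  tree-potential : Fin n → ℚ
  tree-potential v = 1ℚ - ½ * fromℕ (degree G v)

  tree-potential-sum : sumFin tree-potential ≡ 1ℚ
  tree-potential-sum = begin
    sumFin tree-potential
      ≡⟨ sumFin≡sum tree-potential ⟩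
    ∑[ v < n ] (1ℚ - ½ * fromℕ (degree G v))
      ≡⟨ sum-cong-≗ {n} (λ v → cong (_+_ 1ℚ) (ℚP.neg-distribˡ-* ½ (fromℕ (degree G v)))) ⟩
    ∑[ v < n ] (1ℚ + - ½ * fromℕ (degree G v))
      ≡⟨ ∑-distrib-+ (λ _ → 1ℚ) (λ v → - ½ * fromℕ (degree G v)) ⟩
    ∑[ v < n ] 1ℚ + ∑[ v < n ] (- ½ * fromℕ (degree G v))
      ≡⟨ cong₂ _+_ (sum-constℚ n 1ℚ) (sym (*-distribˡ-sum (- ½) (fromℕ ∘ degree G))) ⟩
    fromℕ n * 1ℚ + - ½ * ∑[ v < n ] fromℕ (degree G v)
      ≡⟨ cong (λ s → fromℕ n * 1ℚ + - ½ * s) (trans (sym (fromℕ-sum (degree G))) (cong fromℕ degrees)) ⟩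
    fromℕ n * 1ℚ + - ½ * fromℕ (2 ℕ.* m)
      ≡⟨ cong₂ (λ a b → a * 1ℚ + - ½ * b) (fromℕ-+ 1 m) (fromℕ-* 2 m) ⟩
    (1ℚ + fromℕ m) * 1ℚ + - ½ * (fromℕ 2 * fromℕ m)
      ≡⟨ solve 1 (λ μ → (con 1ℚ :+ μ) :* con 1ℚ :+ con (- ½) :* (con (fromℕ 2) :* μ) := con 1ℚ) refl (fromℕ m) ⟩
    1ℚ
      ∎
    where
    degrees : ℕΣ.sum (degree G) ≡ 2 ℕ.* m
    degrees = trans (TreeLevels.handshake isd acyclic zero) (cong (2 ℕ.*_) (edges≡m zero))

  tree-D· : ∀ u → (D· d) tree-potential u ≡ + m / 2
  tree-D· u = begin
    (D· d) tree-potential u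
      ≡⟨ D·≡sum d tree-potential u ⟩
    ∑[ v < n ] (fromℕ (d u v) * (1ℚ - ½ * fromℕ (degree G v)))
      ≡⟨ sum-cong-≗ {n} term ⟩
    ∑[ v < n ] (fromℕ (depth v) + - ½ * fromℕ (degree G v ℕ.* depth v))
      ≡⟨ ∑-distrib-+ (fromℕ ∘ depth) (λ v → - ½ * fromℕ (degree G v ℕ.* depth v)) ⟩
    ∑[ v < n ] fromℕ (depth v) + ∑[ v < n ] (- ½ * fromℕ (degree G v ℕ.* depth v))
      ≡⟨ cong₂ _+_ (sym (fromℕ-sum depth)) weighted ⟩
    fromℕ S + - ½ * fromℕ T
      ≡⟨ solve 2 (λ a t → a :+ :- con ½ :* t := con ½ :* (con (fromℕ 2) :* a) :+ :- con ½ :* t) refl (fromℕ S) (fromℕ T) ⟩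
    ½ * (fromℕ 2 * fromℕ S) + - ½ * fromℕ T
      ≡⟨ cong (λ s → ½ * s + - ½ * fromℕ T) (sym key) ⟩
    ½ * (fromℕ T + fromℕ m) + - ½ * fromℕ T
      ≡⟨ solve 2 (λ t μ → con ½ :* (t :+ μ) :+ :- con ½ :* t := μ :* con ½) refl (fromℕ T) (fromℕ m) ⟩
    fromℕ m * ½
      ≡⟨ sym (/-suc m 1) ⟩
    + m / 2
      ∎
    where
    open TreeLevels isd acyclic u using (depth; sum-degree*δ)
    S T : ℕ
    S = ℕΣ.sum depth
    T = ℕΣ.∑[ v < n ] (degree G v ℕ.* depth v)
    key : fromℕ T + fromℕ m ≡ fromℕ 2 * fromℕ S
    key = trans (sym (fromℕ-+ T m)) (trans (cong fromℕ (trans (cong (T ℕ.+_) (sym (edges≡m u))) sum-degree*δ)) (fromℕ-* 2 S))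
    term : ∀ v → fromℕ (d u v) * (1ℚ - ½ * fromℕ (degree G v)) ≡ fromℕ (depth v) + - ½ * fromℕ (degree G v ℕ.* depth v)
    term v rewrite d-sym u v | fromℕ-* (degree G v) (depth v) =
      solve 2 (λ δ k → δ :* (con 1ℚ :- con ½ :* k) := δ :+ :- con ½ :* (k :* δ)) refl (fromℕ (depth v)) (fromℕ (degree G v))
    weighted : ∑[ v < n ] (- ½ * fromℕ (degree G v ℕ.* depth v)) ≡ - ½ * fromℕ T
    weighted = trans (sym (*-distribˡ-sum (- ½) (λ v → fromℕ (degree G v ℕ.* depth v))))
                     (cong (- ½ *_) (sym (fromℕ-sum (λ v → degree G v ℕ.* depth v))))

  tree-InX : InX d (λ _ → + m / 2)
  tree-InX = tree-potential , tree-potential-sum , tree-D·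

open import Data.Rational using (_*_; _/_)

theorem4p1 : (m : ℕ) (G : Graph (suc m)) (d : Fin (suc m) → Fin (suc m) → ℕ) →
    Connected G → IsDistance G d →
    (DistanceRegular d →
      CurvatureIndex d (fin ((+ 2 / 1) * Wiener d * (+ 1 / (suc m Data.Nat.* suc m))))) ×
    (IsTree G → CurvatureIndex d (fin (+ m / 2)))
theorem4p1 m G d _ isd = distance-regular , tree
  where
  open ShortestPaths isd

  distance-regular : DistanceRegular d → CurvatureIndex d (fin ((+ 2 / 1) * Wiener d * (+ 1 / (suc m Data.Nat.* suc m))))
  distance-regular regular = subst (CurvatureIndex d ∘ fin) (sym (wiener-transmission {d = d} transmission))
    (CurvatureIndex-intro d-sym (d-refl zero) (transmissionRegular⇒InX {d = d} transmission)
                          (zero-transmission⇒single-vertex isd ∘ /≡0⇒≡0))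
    where
    transmission : ∀ u → ℕΣ.sum (d u) ≡ ℕΣ.sum (d zero)
    transmission u = distanceRegular⇒transmissionRegular d-refl regular u zero

  tree : IsTree G → CurvatureIndex d (fin (+ m / 2))
  tree (_ , acyclic) = CurvatureIndex-intro d-sym (d-refl zero) (tree-InX isd acyclic) /≡0⇒≡0
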